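{- Let $N\ge 3$ and let $W_{N+1}$ be the wheel graph with vertices $v_0,\dots,v_N$, where $v_0,\dots,v_{N-1}$ form a cycle (edges $v_iv_{i+1}$, indices mod $N$) and the central vertex $v_N$ is adjacent to every $v_i$, $0\le i\le N-1$. Let $\tau(W_{N+1};N,0)$ be the number of spanning trees of the multigraph obtained from $W_{N+1}$ by identifying $v_N$ and $v_0$. Then \[ \tau(W_{N+1};N,0)=\begin{cases}F_N(F_{N-1}+F_{N+1}) & \text{if } N \text{ is odd},\\[2mm] \dfrac{L_N(L_N-2)(L_N+2)}{L_{N-1}+L_{N+1}} & \text{if } N \text{ is even}.\end{cases} \]
   Context: Identifying two vertices $u,v$ means replacing them by a single vertex incident to all edges formerly incident to $u$ or $v$ (parallel edges are kept, an edge $uv$ becomes a loop); spanning trees of the resulting multigraph are counted as edge subsets, so parallel edges give distinct trees and loops are never used. $F_n$ denotes the Fibonacci numbers ($F_0=0$, $F_1=1$, $F_{n+2}=F_{n+1}+F_n$) and $L_n$ the Lucas numbers ($L_0=2$, $L_1=1$, $L_{n+2}=L_{n+1}+L_n$). -}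

module Defs where

open import Data.Nat using (ℕ; zero; suc; _+_; _*_; _∸_; _≤_; _<_; s≤s; z≤n; NonZero; >-nonZero)
open import Data.Nat.Properties using (<-≤-trans; m≤m+n; m≤n+m)
open import Data.Nat.DivMod using (_mod_)
open import Data.Fin using (Fin; zero; suc; inject₁; fromℕ; punchOut; _≟_)
open import Data.Fin.Subset using (Subset; _∈_; _∉_; _-_)
open import Data.Vec using (Vec; lookup; tabulate; _++_)
open import Data.List using (List; length)
open import Data.List.Relation.Unary.Unique.Propositional using (Unique)
import Data.List.Membership.Propositional as LM
open import Data.Product using (Σ; _×_; _,_)
open import Relation.Binary.PropositionalEquality using (_≡_; _≢_)
open import Relation.Nullary using (¬_; yes; no)
open import Function.Bundles using (_⇔_)

fib : ℕ → ℕ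
fib zero = 0
fib (suc zero) = 1
fib (suc (suc n)) = fib (suc n) + fib n

lucas : ℕ → ℕ
lucas zero = 2
lucas (suc zero) = 1
lucas (suc (suc n)) = lucas (suc n) + lucas n

-- Finite multigraphs: n vertices, m edges, edge e has endpoints
-- (proj₁ , proj₂) of  edges G e.  Parallel edges and loops allowed.

record Multigraph (n m : ℕ) : Set where
  constructor mkGraph
  field
    edges : Vec (Fin n × Fin n) m
open Multigraph public

data Joins {n m : ℕ} (G : Multigraph n m) (e : Fin m) : Fin n → Fin n → Set where
  fwd : ∀ {u w} → lookup (edges G) e ≡ (u , w) → Joins G e u w
  bwd : ∀ {u w} → lookup (edges G) e ≡ (w , u) → Joins G e u w

data Walk {n m : ℕ} (G : Multigraph n m) (S : Subset m) : Fin n → Fin n → Set where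
  here : ∀ {u} → Walk G S u u
  step : ∀ {u w v} (e : Fin m) → e ∈ S → Joins G e u w → Walk G S w v → Walk G S u v

Connected : {n m : ℕ} → Multigraph n m → Subset m → Set
Connected G S = ∀ u v → Walk G S u v

IsSpanningTree : {n m : ℕ} → Multigraph n m → Subset m → Set
IsSpanningTree G S = Connected G S × (∀ e → e ∈ S → ¬ Connected G (S - e))

SpanningTreeCount : {n m : ℕ} → Multigraph n m → ℕ → Set
SpanningTreeCount {m = m} G k =
  Σ (List (Subset m)) λ L →
    Unique L × (∀ S → (S LM.∈ L) ⇔ IsSpanningTree G S) × length L ≡ k

-- Identifying two distinct vertices u, v of a graph on Fin (suc n):
-- v is deleted and every endpoint v is redirected to u (the other
-- vertices are renumbered by punchOut).  Edge uv becomes a loop.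

mergeMap : {n : ℕ} (u v : Fin (suc n)) → v ≢ u → Fin (suc n) → Fin n
mergeMap u v v≢u w with v ≟ w
... | yes _ = punchOut v≢u
... | no v≢w = punchOut v≢w

identify : {n m : ℕ} (u v : Fin (suc n)) → v ≢ u → Multigraph (suc n) m → Multigraph n m
identify u v p G = mkGraph (tabulate λ e → f (lookup (edges G) e))
  where
    f : _ → _
    f (a , b) = mergeMap u v p a , mergeMap u v p b

-- Wheel W_{N+1}: vertices v_0..v_N (Fin (suc N)), v_N = fromℕ N centre.
-- Edges: cycle edges v_i v_{i+1 mod N} (i < N), then spokes v_i v_N.

wheel : (N : ℕ) → .{{NonZero N}} → Multigraph (suc N) (N + N)
wheel N = mkGraph (tabulate cyc ++ tabulate spoke)
  where
    cyc : Fin N → Fin (suc N) × Fin (suc N)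
    cyc i = inject₁ i , inject₁ ((suc (Data.Fin.toℕ i)) mod N)
    spoke : Fin N → Fin (suc N) × Fin (suc N)
    spoke i = inject₁ i , fromℕ N

vN≢v0 : (N : ℕ) → .{{NonZero N}} → fromℕ N ≢ zero
vN≢v0 (suc N) ()

wheelIdent : (N : ℕ) → .{{NonZero N}} → Multigraph N (N + N)
wheelIdent N = identify zero (fromℕ N) (vN≢v0 N) (wheel N)

lucasSum-nonZero : (N : ℕ) → NonZero (lucas (N ∸ 1) + lucas (suc N))
lucasSum-nonZero N = >-nonZero (<-≤-trans (pos N) (m≤n+m (lucas (suc N)) (lucas (N ∸ 1))) ) 
  where
    pos : (n : ℕ) → 0 < lucas (suc n)
    pos zero = s≤s z≤n
    pos (suc n) = <-≤-trans (pos n) (m≤m+n _ _)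

≥3⇒nonZero : {N : ℕ} → 3 ≤ N → NonZero N
≥3⇒nonZero (s≤s _) = _

{-# OPTIONS --safe #-}
-- Identifying v_N with v_0 leaves the cycle edges c_i = v_i v_(i+1 mod N) and the spokes
-- s_i = v_i v_0, of which s_0 is a loop.  Read along the path v_1, …, v_(N-1), an edge set is a
-- spanning tree iff every block of consecutive vertices linked by cycle edges is joined to v_0 by
-- exactly one edge (a spoke, or c_0 resp. c_(N-1) at the two ends).  A two-state automaton checks
-- this, the state recording whether the current block is already joined to v_0, so the spanning
-- trees are the words of a regular language; counted from the two states they obey the Fibonacci
-- recurrence, giving F_2N trees.  Finally F_2N = F_N (F_(N-1) + F_(N+1)), and for even N the
-- Cassini-type identity L_N² - 4 = 5 F_N² together with L_(N-1) + L_(N+1) = 5 F_N gives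
-- L_N (L_N - 2) (L_N + 2) = F_2N (L_(N-1) + L_(N+1)).
module Submission where

open import Defs
open import Data.Bool using (Bool; true; false)
open import Data.Empty using (⊥; ⊥-elim)
open import Data.Fin as Fin
  using (Fin; zero; suc; toℕ; fromℕ; fromℕ<; inject₁; punchOut; splitAt; _↑ˡ_; _↑ʳ_)
open import Data.Fin.Properties
  using (toℕ-injective; toℕ-fromℕ<; toℕ-↑ˡ; toℕ-↑ʳ; toℕ<n; fromℕ≢inject₁; splitAt⁻¹-↑ˡ; splitAt⁻¹-↑ʳ)
open import Data.Fin.Subset using (Subset; _∈_; _-_)
open import Data.Fin.Subset.Properties using (x∈p∧x≢y⇒x∈p-y; p─⊥≡p)
open import Data.List as List using (List; []; _∷_; length)
open import Data.List.Membership.Propositional using () renaming (_∈_ to _∈ₗ_)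
open import Data.List.Membership.Propositional.Properties
  using (∈-map⁺; ∈-map⁻; ∈-++⁺ˡ; ∈-++⁺ʳ; ∈-++⁻)
open import Data.List.Properties using (length-++; length-map)
open import Data.List.Relation.Binary.Disjoint.Propositional using (Disjoint)
open import Data.List.Relation.Unary.All using ([]; _∷_)
open import Data.List.Relation.Unary.AllPairs using ([]; _∷_)
open import Data.List.Relation.Unary.Any using (here; there)
open import Data.List.Relation.Unary.Unique.Propositional using (Unique)
import Data.List.Relation.Unary.Unique.Propositional.Properties as Unique
open import Data.Nat using (ℕ; zero; suc; _+_; _*_; _∸_; _≤_; _<_; s≤s; z≤n; _<?_; _≟_; NonZero)
open import Data.Nat.DivMod
  using (_/_; _%_; _mod_; m*n/n≡m; /-congˡ; m<n⇒m%n≡m; n%n≡0; m%n<n)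
open import Data.Nat.Properties
open import Data.Nat.Tactic.RingSolver using (solve-∀)
open import Data.Product using (Σ-syntax; _×_; _,_; proj₁; proj₂; swap; uncurry)
open import Data.Product.Properties using (,-injective)
open import Data.Sum using (_⊎_; inj₁; inj₂)
open import Data.Vec as Vec using (Vec; []; _∷_; _++_; lookup; tabulate; here; there)
open import Data.Vec.Properties
  using (∷-injective; ++-injective; lookup∘tabulate; lookup-++ˡ; lookup-++ʳ)
open import Function using (_∘_)
open import Function.Bundles using (_⇔_; mk⇔; Equivalence)
open import Relation.Binary.PropositionalEquality
open import Relation.Nullary using (¬_; yes; no)
open import Algebra.Properties.CommutativeSemigroup +-commutativeSemigroup
  using () renaming (interchange to +-interchange)
open ≡-Reasoning

-- Fibonacci and Lucas identities

[m∸n]*[m+n]≡m*m∸n*n : ∀ m n → (m ∸ n) * (m + n) ≡ m * m ∸ n * n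
[m∸n]*[m+n]≡m*m∸n*n m n = begin
  (m ∸ n) * (m + n)                       ≡⟨ *-distribʳ-∸ (m + n) m n ⟩
  m * (m + n) ∸ n * (m + n)               ≡⟨ cong₂ _∸_ (expandˡ m n) (expandʳ m n) ⟩
  (m * n + m * m) ∸ (m * n + n * n)       ≡⟨ [m+n]∸[m+o]≡n∸o (m * n) (m * m) (n * n) ⟩
  m * m ∸ n * n                           ∎
  where
  expandˡ : ∀ a b → a * (a + b) ≡ a * b + a * a
  expandˡ = solve-∀
  expandʳ : ∀ a b → b * (a + b) ≡ a * b + b * b
  expandʳ = solve-∀

fib-+ : ∀ m n → fib (suc (m + n)) ≡ fib (suc m) * fib (suc n) + fib m * fib n
fib-+ zero          n = base (fib (suc n)) (fib n)
  where
  base : ∀ x y → x ≡ 1 * x + 0 * y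
  base = solve-∀
fib-+ (suc zero)    n = base (fib (suc n)) (fib n)
  where
  base : ∀ x y → x + y ≡ 1 * x + 1 * y
  base = solve-∀
fib-+ (suc (suc m)) n = begin
  fib (suc (suc m + n)) + fib (suc (m + n))
    ≡⟨ cong₂ _+_ (fib-+ (suc m) n) (fib-+ m n) ⟩
  (f₂ * x + f₁ * y) + (f₁ * x + f₀ * y)
    ≡⟨ regroup f₂ f₁ f₀ x y ⟩
  (f₂ + f₁) * x + (f₁ + f₀) * y
    ∎
  where
  f₂ f₁ f₀ x y : ℕ
  f₂ = fib (suc (suc m)); f₁ = fib (suc m); f₀ = fib m; x = fib (suc n); y = fib n
  regroup : ∀ a b c x y → (a * x + b * y) + (b * x + c * y) ≡ (a + b) * x + (b + c) * y
  regroup = solve-∀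

fib-double : ∀ n → fib (suc n + suc n) ≡ fib (suc n) * (fib n + fib (suc (suc n)))
fib-double n = trans (fib-+ n (suc n)) (factor (fib (suc n)) (fib n) (fib (suc (suc n))))
  where
  factor : ∀ x y z → x * z + y * x ≡ x * (y + z)
  factor = solve-∀

lucas≡fib+fib : ∀ n → lucas (suc n) ≡ fib n + fib (suc (suc n))
lucas≡fib+fib zero          = refl
lucas≡fib+fib (suc zero)    = refl
lucas≡fib+fib (suc (suc n)) = begin
  lucas (suc (suc n)) + lucas (suc n)
    ≡⟨ cong₂ _+_ (lucas≡fib+fib (suc n)) (lucas≡fib+fib n) ⟩
  (fib (suc n) + fib (suc (suc (suc n)))) + (fib n + fib (suc (suc n)))
    ≡⟨ +-interchange (fib (suc n)) (fib (suc (suc (suc n)))) (fib n) (fib (suc (suc n))) ⟩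
  (fib (suc n) + fib n) + (fib (suc (suc (suc n))) + fib (suc (suc n)))
    ∎

lucas+lucas≡5*fib : ∀ n → lucas n + lucas (suc (suc n)) ≡ 5 * fib (suc n)
lucas+lucas≡5*fib zero          = refl
lucas+lucas≡5*fib (suc zero)    = refl
lucas+lucas≡5*fib (suc (suc n)) = begin
  (lucas (suc n) + lucas n) + (lucas (suc (suc (suc n))) + lucas (suc (suc n)))
    ≡⟨ +-interchange (lucas (suc n)) (lucas n) (lucas (suc (suc (suc n)))) (lucas (suc (suc n))) ⟩
  (lucas (suc n) + lucas (suc (suc (suc n)))) + (lucas n + lucas (suc (suc n)))
    ≡⟨ cong₂ _+_ (lucas+lucas≡5*fib (suc n)) (lucas+lucas≡5*fib n) ⟩
  5 * fib (suc (suc n)) + 5 * fib (suc n)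
    ≡⟨ *-distribˡ-+ 5 (fib (suc (suc n))) (fib (suc n)) ⟨
  5 * fib (suc (suc (suc n)))
    ∎

cassini-step : ∀ n → fib (suc n) * fib (suc (suc (suc n))) + fib n * fib (suc (suc n))
                     ≡ fib (suc (suc n)) * fib (suc (suc n)) + fib (suc n) * fib (suc n)
cassini-step n = identity (fib n) (fib (suc n))
  where
  identity : ∀ a b → b * ((b + a) + b) + a * (b + a) ≡ (b + a) * (b + a) + b * b
  identity = solve-∀

cassini-even : ∀ p → fib (p + p) * fib (suc (suc (p + p))) + 1 ≡ fib (suc (p + p)) * fib (suc (p + p))
cassini-odd  : ∀ p → fib (suc (p + p)) * fib (suc (suc (suc (p + p))))
                     ≡ fib (suc (suc (p + p))) * fib (suc (suc (p + p))) + 1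

cassini-even zero    = refl
cassini-even (suc p) rewrite +-suc p p = +-cancelʳ-≡ (f₂ * f₂) (f₂ * f₄ + 1) (f₃ * f₃) (begin
  (f₂ * f₄ + 1) + f₂ * f₂ ≡⟨ regroup (f₂ * f₄) (f₂ * f₂) ⟩
  f₂ * f₄ + (f₂ * f₂ + 1) ≡⟨ cong (f₂ * f₄ +_) (cassini-odd p) ⟨
  f₂ * f₄ + f₁ * f₃       ≡⟨ cassini-step (suc (p + p)) ⟩
  f₃ * f₃ + f₂ * f₂       ∎)
  where
  f₁ f₂ f₃ f₄ : ℕ
  f₁ = fib (suc (p + p)); f₂ = fib (suc (suc (p + p)))
  f₃ = fib (suc (suc (suc (p + p)))); f₄ = fib (suc (suc (suc (suc (p + p)))))
  regroup : ∀ x y → (x + 1) + y ≡ x + (y + 1)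
  regroup = solve-∀

cassini-odd p = +-cancelʳ-≡ (f₀ * f₂) (f₁ * f₃) (f₂ * f₂ + 1) (begin
  f₁ * f₃ + f₀ * f₂       ≡⟨ cassini-step (p + p) ⟩
  f₂ * f₂ + f₁ * f₁       ≡⟨ cong (f₂ * f₂ +_) (cassini-even p) ⟨
  f₂ * f₂ + (f₀ * f₂ + 1) ≡⟨ regroup (f₂ * f₂) (f₀ * f₂) ⟩
  (f₂ * f₂ + 1) + f₀ * f₂ ∎)
  where
  f₀ f₁ f₂ f₃ : ℕ
  f₀ = fib (p + p); f₁ = fib (suc (p + p))
  f₂ = fib (suc (suc (p + p))); f₃ = fib (suc (suc (suc (p + p))))
  regroup : ∀ x y → x + (y + 1) ≡ (x + 1) + y
  regroup = solve-∀

lucas²-even : ∀ p → let N = suc (suc (p + p)) in lucas N * lucas N ≡ 5 * (fib N * fib N) + 4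
lucas²-even p = begin
  lucas (suc n) * lucas (suc n)   ≡⟨ cong (λ x → x * x) (lucas≡fib+fib n) ⟩
  (a + (b + a)) * (a + (b + a))   ≡⟨ square a b ⟩
  4 * (a * (b + a)) + b * b       ≡⟨ cong (λ x → 4 * x + b * b) (cassini-odd p) ⟩
  4 * (b * b + 1) + b * b         ≡⟨ collect (b * b) ⟩
  5 * (b * b) + 4                 ∎
  where
  n a b : ℕ
  n = suc (p + p); a = fib n; b = fib (suc n)
  square : ∀ a b → (a + (b + a)) * (a + (b + a)) ≡ 4 * (a * (b + a)) + b * b
  square = solve-∀
  collect : ∀ x → 4 * (x + 1) + x ≡ 5 * x + 4
  collect = solve-∀

lucas-product-even : ∀ p → let N = suc (suc (p + p)) in
  lucas N * (lucas N ∸ 2) * (lucas N + 2) ≡ fib (N + N) * (lucas (N ∸ 1) + lucas (suc N))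
lucas-product-even p = begin
  L * (L ∸ 2) * (L + 2)     ≡⟨ *-assoc L (L ∸ 2) (L + 2) ⟩
  L * ((L ∸ 2) * (L + 2))   ≡⟨ cong (L *_) ([m∸n]*[m+n]≡m*m∸n*n L 2) ⟩
  L * (L * L ∸ 4)           ≡⟨ cong (λ x → L * (x ∸ 4)) (lucas²-even p) ⟩
  L * (5 * (F * F) + 4 ∸ 4) ≡⟨ cong (L *_) (m+n∸n≡m (5 * (F * F)) 4) ⟩
  L * (5 * (F * F))         ≡⟨ regroup L F ⟩
  (F * L) * (5 * F)         ≡⟨ cong₂ _*_ (cong (F *_) (lucas≡fib+fib n))
                                         (sym (lucas+lucas≡5*fib n)) ⟩
  (F * (fib n + fib (suc N))) * (lucas n + lucas (suc N))
                            ≡⟨ cong (_* (lucas n + lucas (suc N))) (fib-double n) ⟨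
  fib (N + N) * (lucas n + lucas (suc N)) ∎
  where
  n N L F : ℕ
  n = suc (p + p); N = suc n; L = lucas N; F = fib N
  regroup : ∀ l f → l * (5 * (f * f)) ≡ (f * l) * (5 * f)
  regroup = solve-∀

even-cases : ∀ N → N % 2 ≡ 0 → N ≡ 0 ⊎ Σ[ p ∈ ℕ ] N ≡ suc (suc (p + p))
even-cases zero          _ = inj₁ refl
even-cases (suc (suc N)) even with even-cases N even
... | inj₁ refl       = inj₂ (0 , refl)
... | inj₂ (p , refl) = inj₂ (suc p , cong (3 +_) (sym (+-suc p p)))

fib-double≡lucas-quotient : ∀ N → N % 2 ≡ 0 →
  fib (N + N) ≡ _/_ (lucas N * (lucas N ∸ 2) * (lucas N + 2))
                    (lucas (N ∸ 1) + lucas (suc N)) {{lucasSum-nonZero N}}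
fib-double≡lucas-quotient N even with even-cases N even
... | inj₁ refl       = refl
... | inj₂ (p , refl) = sym (trans (/-congˡ {{nz}} (lucas-product-even p)) (m*n/n≡m _ _ {{nz}}))
  where
  nz : NonZero (lucas (suc (p + p)) + lucas (suc (suc (suc (p + p)))))
  nz = lucasSum-nonZero (suc (suc (p + p)))

-- Subsets as bit vectors

bit : ∀ {n} → Subset n → ℕ → Bool
bit []      _       = false
bit (x ∷ p) zero    = x
bit (x ∷ p) (suc k) = bit p k

∈⇒bit : ∀ {n} {p : Subset n} {i} → i ∈ p → bit p (toℕ i) ≡ true
∈⇒bit here       = refl
∈⇒bit (there i∈p) = ∈⇒bit i∈p

bit⇒∈ : ∀ {n} {p : Subset n} {i} → bit p (toℕ i) ≡ true → i ∈ p
bit⇒∈ {p = _ ∷ _} {zero}  refl = here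
bit⇒∈ {p = _ ∷ _} {suc i} eq   = there (bit⇒∈ eq)

bit-─ : ∀ {n} (p : Subset n) i {k} → k ≢ toℕ i → bit (p - i) k ≡ bit p k
bit-─ (x ∷ p) zero    {zero}  k≢i = ⊥-elim (k≢i refl)
bit-─ (x ∷ p) zero    {suc k} _   = cong (λ q → bit q k) (p─⊥≡p p)
bit-─ (x ∷ p) (suc i) {zero}  _   = refl
bit-─ (x ∷ p) (suc i) {suc k} k≢i = bit-─ p i (k≢i ∘ cong suc)

bit-─-self : ∀ {n} (p : Subset n) i → bit (p - i) (toℕ i) ≡ false
bit-─-self (x ∷ p) zero    = refl
bit-─-self (x ∷ p) (suc i) = bit-─-self p i

bits-≢ : ∀ {n} (p : Subset n) {k l} → bit p k ≡ true → bit p l ≡ false → k ≢ l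
bits-≢ _ pk pl refl with trans (sym pk) pl
... | ()

bit-─-false : ∀ {n} (p : Subset n) i {k} → bit p k ≡ false → bit (p - i) k ≡ false
bit-─-false p i {k} pk with k ≟ toℕ i
... | yes refl = bit-─-self p i
... | no k≢i   = trans (bit-─ p i k≢i) pk

bit-++ˡ : ∀ {m n} (xs : Vec Bool m) (ys : Vec Bool n) {k} → k < m → bit (xs ++ ys) k ≡ bit xs k
bit-++ˡ (x ∷ xs) ys {zero}  _   = refl
bit-++ˡ (x ∷ xs) ys {suc k} k<m = bit-++ˡ xs ys (≤-pred k<m)

bit-++ʳ : ∀ {m n} (xs : Vec Bool m) (ys : Vec Bool n) k → bit (xs ++ ys) (m + k) ≡ bit ys k
bit-++ʳ []       ys k = refl
bit-++ʳ (x ∷ xs) ys k = bit-++ʳ xs ys k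

-- Walks

module _ {n m : ℕ} {G : Multigraph n m} where

  Joins-sym : ∀ {e u w} → Joins G e u w → Joins G e w u
  Joins-sym (fwd eq) = bwd eq
  Joins-sym (bwd eq) = fwd eq

  infixr 5 _◅◅_

  _◅◅_ : ∀ {S u v w} → Walk G S u v → Walk G S v w → Walk G S u w
  here              ◅◅ W′ = W′
  step e e∈S j W ◅◅ W′ = step e e∈S j (W ◅◅ W′)

  reverse : ∀ {S u v} → Walk G S u v → Walk G S v u
  reverse here              = here
  reverse (step e e∈S j W) = reverse W ◅◅ step e e∈S (Joins-sym j) here

  connected-via : ∀ {S} (z : Fin n) → (∀ u → Walk G S u z) → Connected G S
  connected-via z to-z u v = to-z u ◅◅ reverse (to-z v)

  Joins-ends : ∀ {e a b u w} → Joins G e a b → Joins G e u w →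
               (a ≡ u × b ≡ w) ⊎ (a ≡ w × b ≡ u)
  Joins-ends (fwd p) (fwd q) = inj₁ (,-injective (trans (sym p) q))
  Joins-ends (fwd p) (bwd q) = inj₂ (,-injective (trans (sym p) q))
  Joins-ends (bwd p) (fwd q) = inj₂ (swap (,-injective (trans (sym p) q)))
  Joins-ends (bwd p) (bwd q) = inj₁ (swap (,-injective (trans (sym p) q)))

  reroute : ∀ {S e a b u w} → Joins G e a b → Joins G e u w → Walk G S a b → Walk G S u w
  reroute j j′ W with Joins-ends j j′
  ... | inj₁ (refl , refl) = W
  ... | inj₂ (refl , refl) = reverse W

  bypass : ∀ {S e a b u v} → Joins G e a b → Walk G (S - e) a b → Walk G S u v → Walk G (S - e) u v
  bypass j W here = here
  bypass {e = e} j W (step e′ e′∈S j′ rest) with e′ Fin.≟ e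
  ... | yes refl = reroute j j′ W ◅◅ bypass j W rest
  ... | no e′≢e  = step e′ (x∈p∧x≢y⇒x∈p-y e′∈S e′≢e) j′ (bypass j W rest)

  spanning-tree-edge-is-bridge : ∀ {T e a b} → IsSpanningTree G T → e ∈ T → Joins G e a b →
                                 ¬ Walk G (T - e) a b
  spanning-tree-edge-is-bridge (connected , minimal) e∈T j W =
    minimal _ e∈T (λ u v → bypass j W (connected u v))

  walk-preserves : ∀ {S u v} (P : Fin n → Set) → (∀ {e a b} → e ∈ S → Joins G e a b → P a → P b) →
                   Walk G S u v → P u → P v
  walk-preserves P closed here              Pu = Pu
  walk-preserves P closed (step e e∈S j W) Pu = walk-preserves P closed W (closed e∈S j Pu)

-- A two-state automaton and its language

-- Step q c s q′: at vertex j in state q (is the block of vertices ending at j already joined to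
-- the hub?), the bits c = [c_j ∈ T] and s = [s_j ∈ T] lead to state q′ at j + 1.  At the last
-- vertex c_j also ends at the hub, which Final accounts for.
data Step : Bool → Bool → Bool → Bool → Set where
  grow      : ∀ {q} → Step q true false q
  hook-grow : Step false true true true
  hook-end  : Step false false true false
  end       : Step true false false false

data Final : Bool → Bool → Bool → Set where
  hook-closing : Final false true false
  hook-spoke   : Final false false true
  done         : Final true false false

data Run (c s : ℕ → Bool) (e : ℕ) : ℕ → Bool → Set where
  stop : ∀ {q a b} → Final q a b → c e ≡ a → s e ≡ b → Run c s e e q
  next : ∀ {j q q′ a b} → Step q a b q′ → c j ≡ a → s j ≡ b →
         Run c s e (suc j) q′ → Run c s e j q

module _ {c s : ℕ → Bool} where

  Run-≤ : ∀ {e j q} → Run c s e j q → j ≤ e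
  Run-≤ (stop _ _ _)   = ≤-refl
  Run-≤ (next _ _ _ R) = <⇒≤ (Run-≤ R)

  Run-shift⁻ : ∀ {e j q} → Run c s (suc e) (suc j) q → Run (c ∘ suc) (s ∘ suc) e j q
  Run-shift⁻ (stop F ce se)    = stop F ce se
  Run-shift⁻ (next st cj sj R) = next st cj sj (Run-shift⁻ R)

  Run-shift⁺ : ∀ {e j q} → Run (c ∘ suc) (s ∘ suc) e j q → Run c s (suc e) (suc j) q
  Run-shift⁺ (stop F ce se)    = stop F ce se
  Run-shift⁺ (next st cj sj R) = next st cj sj (Run-shift⁺ R)

  Run-cong : ∀ {c′ s′ e j q} → (∀ {i} → i ≤ e → c i ≡ c′ i) → (∀ {i} → i ≤ e → s i ≡ s′ i) →
             Run c s e j q → Run c′ s′ e j q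
  Run-cong c≗ s≗ (stop F ce se) =
    stop F (trans (sym (c≗ ≤-refl)) ce) (trans (sym (s≗ ≤-refl)) se)
  Run-cong {e = e} {j} c≗ s≗ (next st cj sj R) =
    next st (trans (sym (c≗ j≤e)) cj) (trans (sym (s≗ j≤e)) sj) (Run-cong c≗ s≗ R)
    where
    j≤e : j ≤ e
    j≤e = <⇒≤ (Run-≤ R)

Word : ℕ → Set
Word k = Vec Bool k × Vec Bool k

Accepts : ∀ {k} → Word (suc k) → Bool → Set
Accepts {k} (cs , ss) q = Run (bit cs) (bit ss) k 0 q

infixr 5 _∷ʷ_

_∷ʷ_ : ∀ {k} → Bool × Bool → Word k → Word (suc k)
(c , s) ∷ʷ (cs , ss) = c ∷ cs , s ∷ ss

prepend : ∀ {k} → Bool × Bool → List (Word k) → List (Word (suc k))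
prepend l = List.map (l ∷ʷ_)

accepted : ∀ k → Bool → List (Word (suc k))
accepted zero    false = ((true , false) ∷ʷ ([] , [])) ∷ ((false , true) ∷ʷ ([] , [])) ∷ []
accepted zero    true  = ((false , false) ∷ʷ ([] , [])) ∷ []
accepted (suc k) false = prepend (true , false) (accepted k false)
                  List.++ prepend (true , true) (accepted k true)
                  List.++ prepend (false , true) (accepted k false)
accepted (suc k) true  = prepend (true , false) (accepted k true)
                  List.++ prepend (false , false) (accepted k false)

prepend-sound : ∀ {k q q′ a b} {ws : List (Word (suc k))} → Step q a b q′ →
                (∀ {w} → w ∈ₗ ws → Accepts w q′) →
                ∀ {w} → w ∈ₗ prepend (a , b) ws → Accepts w q
prepend-sound st sound w∈ with ∈-map⁻ _ w∈
... | w′ , w′∈ , refl = next st refl refl (Run-shift⁺ (sound w′∈))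

accepted-sound : ∀ k q {w} → w ∈ₗ accepted k q → Accepts w q
accepted-sound zero false (here refl)         = stop hook-closing refl refl
accepted-sound zero false (there (here refl)) = stop hook-spoke refl refl
accepted-sound zero true  (here refl)         = stop done refl refl
accepted-sound (suc k) false w∈ with ∈-++⁻ (prepend _ (accepted k false)) w∈
... | inj₁ w∈₁ = prepend-sound grow (accepted-sound k false) w∈₁
... | inj₂ w∈₂ with ∈-++⁻ (prepend _ (accepted k true)) w∈₂
...   | inj₁ w∈₃ = prepend-sound hook-grow (accepted-sound k true) w∈₃
...   | inj₂ w∈₃ = prepend-sound hook-end (accepted-sound k false) w∈₃
accepted-sound (suc k) true w∈ with ∈-++⁻ (prepend _ (accepted k true)) w∈
... | inj₁ w∈₁ = prepend-sound grow (accepted-sound k true) w∈₁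
... | inj₂ w∈₂ = prepend-sound end (accepted-sound k false) w∈₂

accepted-complete : ∀ k q (w : Word (suc k)) → Accepts w q → w ∈ₗ accepted k q
accepted-complete zero q (c ∷ [] , s ∷ []) (stop hook-closing refl refl) = here refl
accepted-complete zero q (c ∷ [] , s ∷ []) (stop hook-spoke refl refl)   = there (here refl)
accepted-complete zero q (c ∷ [] , s ∷ []) (stop done refl refl)         = here refl
accepted-complete zero q (c ∷ [] , s ∷ []) (next _ _ _ R) = ⊥-elim (1+n≰n (Run-≤ R))
accepted-complete (suc k) false (c ∷ cs , s ∷ ss) (next grow refl refl R) =
  ∈-++⁺ˡ (∈-map⁺ _ (accepted-complete k false (cs , ss) (Run-shift⁻ R)))
accepted-complete (suc k) false (c ∷ cs , s ∷ ss) (next hook-grow refl refl R) =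
  ∈-++⁺ʳ (prepend _ (accepted k false))
    (∈-++⁺ˡ (∈-map⁺ _ (accepted-complete k true (cs , ss) (Run-shift⁻ R))))
accepted-complete (suc k) false (c ∷ cs , s ∷ ss) (next hook-end refl refl R) =
  ∈-++⁺ʳ (prepend _ (accepted k false)) (∈-++⁺ʳ (prepend _ (accepted k true))
    (∈-map⁺ _ (accepted-complete k false (cs , ss) (Run-shift⁻ R))))
accepted-complete (suc k) true  (c ∷ cs , s ∷ ss) (next grow refl refl R) =
  ∈-++⁺ˡ (∈-map⁺ _ (accepted-complete k true (cs , ss) (Run-shift⁻ R)))
accepted-complete (suc k) true  (c ∷ cs , s ∷ ss) (next end refl refl R) =
  ∈-++⁺ʳ (prepend _ (accepted k true))
    (∈-map⁺ _ (accepted-complete k false (cs , ss) (Run-shift⁻ R)))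

∷ʷ-injectiveˡ : ∀ {k l l′} {w w′ : Word k} → l ∷ʷ w ≡ l′ ∷ʷ w′ → l ≡ l′
∷ʷ-injectiveˡ {l = _ , _} {_ , _} {_ , _} {_ , _} eq
  with ∷-injective (cong proj₁ eq) | ∷-injective (cong proj₂ eq)
... | refl , _ | refl , _ = refl

∷ʷ-injective : ∀ {k l} {w w′ : Word k} → l ∷ʷ w ≡ l ∷ʷ w′ → w ≡ w′
∷ʷ-injective {w = _ , _} {_ , _} eq with ∷-injective (cong proj₁ eq) | ∷-injective (cong proj₂ eq)
... | _ , refl | _ , refl = refl

prepend-disjoint : ∀ {k l l′} {ws ws′ : List (Word k)} → l ≢ l′ →
                   Disjoint (prepend l ws) (prepend l′ ws′)
prepend-disjoint {l = l} {l′} l≢l′ (w∈ , w∈′)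
  with ∈-map⁻ (l ∷ʷ_) w∈ | ∈-map⁻ (l′ ∷ʷ_) w∈′
... | _ , _ , refl | _ , _ , eq = l≢l′ (∷ʷ-injectiveˡ eq)

disjoint-++ : ∀ {A : Set} {xs ys zs : List A} → Disjoint xs ys → Disjoint xs zs →
              Disjoint xs (ys List.++ zs)
disjoint-++ {ys = ys} xs#ys xs#zs (v∈xs , v∈ys++zs) with ∈-++⁻ ys v∈ys++zs
... | inj₁ v∈ys = xs#ys (v∈xs , v∈ys)
... | inj₂ v∈zs = xs#zs (v∈xs , v∈zs)

prepend-unique : ∀ {k l} {ws : List (Word k)} → Unique ws → Unique (prepend l ws)
prepend-unique = Unique.map⁺ ∷ʷ-injective

accepted-unique : ∀ k q → Unique (accepted k q)
accepted-unique zero    false = ((λ ()) ∷ []) ∷ [] ∷ []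
accepted-unique zero    true  = [] ∷ []
accepted-unique (suc k) false =
  Unique.++⁺ (prepend-unique (accepted-unique k false))
         (Unique.++⁺ (prepend-unique (accepted-unique k true)) (prepend-unique (accepted-unique k false))
                 (prepend-disjoint (λ ())))
         (disjoint-++ {ys = prepend (true , true) (accepted k true)}
                      (prepend-disjoint (λ ())) (prepend-disjoint (λ ())))
accepted-unique (suc k) true  =
  Unique.++⁺ (prepend-unique (accepted-unique k true)) (prepend-unique (accepted-unique k false))
         (prepend-disjoint (λ ()))

length-prepend : ∀ {k} l (ws : List (Word k)) → length (prepend l ws) ≡ length ws
length-prepend l = length-map (l ∷ʷ_)

length-accepted : ∀ k → length (accepted k true)  ≡ fib (suc k + suc k)
                      × length (accepted k false) ≡ fib (suc (suc k + suc k))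
length-accepted zero    = refl , refl
length-accepted (suc k) = length-true , length-false
  where
  t f : ℕ
  t = fib (suc k + suc k)
  f = fib (suc (suc k + suc k))
  length-t : ∀ l → length (prepend l (accepted k true)) ≡ t
  length-t l = trans (length-prepend l (accepted k true)) (proj₁ (length-accepted k))
  length-f : ∀ l → length (prepend l (accepted k false)) ≡ f
  length-f l = trans (length-prepend l (accepted k false)) (proj₂ (length-accepted k))
  index : suc (suc k) + suc (suc k) ≡ suc (suc (suc k + suc k))
  index = cong suc (+-suc (suc k) (suc k))
  length-true : length (accepted (suc k) true) ≡ fib (suc (suc k) + suc (suc k))
  length-true = begin
    length (prepend (true , false) (accepted k true) List.++ prepend (false , false) (accepted k false))
      ≡⟨ length-++ (prepend (true , false) (accepted k true)) ⟩
    length (prepend (true , false) (accepted k true)) + length (prepend (false , false) (accepted k false))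
      ≡⟨ cong₂ _+_ (length-t (true , false)) (length-f (false , false)) ⟩
    t + f
      ≡⟨ +-comm t f ⟩
    fib (suc (suc (suc k + suc k)))
      ≡⟨ cong fib index ⟨
    fib (suc (suc k) + suc (suc k))
      ∎
  length-false : length (accepted (suc k) false) ≡ fib (suc (suc (suc k) + suc (suc k)))
  length-false = begin
    length (prepend (true , false) (accepted k false) List.++ tail)
      ≡⟨ length-++ (prepend (true , false) (accepted k false)) ⟩
    length (prepend (true , false) (accepted k false)) + length tail
      ≡⟨ cong₂ _+_ (length-f (true , false)) (length-++ (prepend (true , true) (accepted k true))) ⟩
    f + (length (prepend (true , true) (accepted k true))
           + length (prepend (false , true) (accepted k false)))
      ≡⟨ cong (f +_) (cong₂ _+_ (length-t (true , true)) (length-f (false , true))) ⟩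
    f + (t + f)
      ≡⟨ +-assoc f t f ⟨
    fib (suc (suc (suc (suc k + suc k))))
      ≡⟨ cong (fib ∘ suc) index ⟨
    fib (suc (suc (suc k) + suc (suc k)))
      ∎
    where
    tail : List (Word (suc (suc k)))
    tail = prepend (true , true) (accepted k true) List.++ prepend (false , true) (accepted k false)

-- The identified wheel

data Split (m n : ℕ) : Fin (m + n) → Set where
  left  : ∀ i → Split m n (i ↑ˡ n)
  right : ∀ i → Split m n (m ↑ʳ i)

split : ∀ m n (i : Fin (m + n)) → Split m n i
split m n i with splitAt m i in eq
... | inj₁ j = subst (Split m n) (splitAt⁻¹-↑ˡ eq) (left j)
... | inj₂ j = subst (Split m n) (splitAt⁻¹-↑ʳ eq) (right j)

punchOut-fromℕ-inject₁ : ∀ {n} (i : Fin n) (p : fromℕ n ≢ inject₁ i) → punchOut p ≡ i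
punchOut-fromℕ-inject₁ {suc n} zero    p = refl
punchOut-fromℕ-inject₁ {suc n} (suc i) p = cong suc (punchOut-fromℕ-inject₁ i (p ∘ cong suc))

mergeMap-inject₁ : ∀ {n} (p : fromℕ n ≢ zero) (i : Fin n) →
                   mergeMap zero (fromℕ n) p (inject₁ i) ≡ i
mergeMap-inject₁ {n} p i with fromℕ n Fin.≟ inject₁ i
... | yes eq = ⊥-elim (fromℕ≢inject₁ eq)
... | no ne  = punchOut-fromℕ-inject₁ i ne

mergeMap-fromℕ : ∀ {n} (p : fromℕ (suc n) ≢ zero) →
                 mergeMap zero (fromℕ (suc n)) p (fromℕ (suc n)) ≡ zero
mergeMap-fromℕ {n} p with fromℕ (suc n) Fin.≟ fromℕ (suc n)
... | yes _  = refl
... | no ne  = ⊥-elim (ne refl)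

module _ (n : ℕ) where

  private
    N : ℕ
    N = suc n

    cycle-ends : Fin N → Fin (suc N) × Fin (suc N)
    cycle-ends i = inject₁ i , inject₁ (suc (toℕ i) mod N)

    spoke-ends : Fin N → Fin (suc N) × Fin (suc N)
    spoke-ends i = inject₁ i , fromℕ N

    merge : Fin (suc N) → Fin N
    merge = mergeMap zero (fromℕ N) (vN≢v0 N)

    merge-ends : ∀ e {a b} → lookup (edges (wheel N)) e ≡ (a , b) →
                 lookup (edges (wheelIdent N)) e ≡ (merge a , merge b)
    merge-ends e eq =
      trans (lookup∘tabulate (merge-pair ∘ lookup (edges (wheel N))) e) (cong merge-pair eq)
      where
      merge-pair : Fin (suc N) × Fin (suc N) → Fin N × Fin N
      merge-pair (a , b) = merge a , merge b

  wheelIdent-cycle : ∀ i → lookup (edges (wheelIdent (suc n))) (i ↑ˡ suc n)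
                           ≡ (i , suc (toℕ i) mod suc n)
  wheelIdent-cycle i =
    trans (merge-ends (i ↑ˡ N) (trans (lookup-++ˡ (tabulate cycle-ends) (tabulate spoke-ends) i)
                                       (lookup∘tabulate cycle-ends i)))
          (cong₂ _,_ (mergeMap-inject₁ (vN≢v0 N) i) (mergeMap-inject₁ (vN≢v0 N) _))

  wheelIdent-spoke : ∀ i → lookup (edges (wheelIdent (suc n))) (suc n ↑ʳ i) ≡ (i , zero)
  wheelIdent-spoke i =
    trans (merge-ends (N ↑ʳ i) (trans (lookup-++ʳ (tabulate cycle-ends) (tabulate spoke-ends) i)
                                       (lookup∘tabulate spoke-ends i)))
          (cong₂ _,_ (mergeMap-inject₁ (vN≢v0 N) i) (mergeMap-fromℕ (vN≢v0 N)))

module IdentifiedWheel (m : ℕ) where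

  N M : ℕ
  N = suc (suc (suc m))
  M = suc (suc m)

  G : Multigraph N (N + N)
  G = wheelIdent N

  spokeBit : Subset (N + N) → ℕ → Bool
  spokeBit T i = bit T (N + i)

  -- Vertex 0 is the merged vertex v_0 = v_N; edge i < N is the cycle edge c_i and edge N + i
  -- the spoke s_i.
  data EdgeAt : ℕ → ℕ → ℕ → Set where
    cycle   : ∀ {i} → suc i < N → EdgeAt i i (suc i)
    closing : EdgeAt M M 0
    spoke   : ∀ {i} → i < N → EdgeAt (N + i) i 0

  cycle-or-closing : ∀ {i} → i < N → EdgeAt i i (suc i % N)
  cycle-or-closing {i} i<N with m≤n⇒m<n∨m≡n i<N
  ... | inj₁ 1+i<N = subst (EdgeAt i i) (sym (m<n⇒m%n≡m 1+i<N)) (cycle 1+i<N)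
  ... | inj₂ refl  = subst (EdgeAt M M) (sym (n%n≡0 N)) closing

  edgeAt : ∀ e → EdgeAt (toℕ e) (toℕ (proj₁ (lookup (edges G) e)))
                                (toℕ (proj₂ (lookup (edges G) e)))
  edgeAt e with split N N e
  ... | left i  rewrite wheelIdent-cycle (suc (suc m)) i | toℕ-↑ˡ i N
                      | toℕ-fromℕ< (m%n<n (suc (toℕ i)) N) = cycle-or-closing (toℕ<n i)
  ... | right i rewrite wheelIdent-spoke (suc (suc m)) i | toℕ-↑ʳ N i = spoke (toℕ<n i)

  private
    EdgeAt-ends : Fin (N + N) → Fin N × Fin N → Set
    EdgeAt-ends e (u , w) = EdgeAt (toℕ e) (toℕ u) (toℕ w)

  Joins⇒EdgeAt : ∀ {e u w} → Joins G e u w →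
                 EdgeAt (toℕ e) (toℕ u) (toℕ w) ⊎ EdgeAt (toℕ e) (toℕ w) (toℕ u)
  Joins⇒EdgeAt {e} (fwd eq) = inj₁ (subst (EdgeAt-ends e) eq (edgeAt e))
  Joins⇒EdgeAt {e} (bwd eq) = inj₂ (subst (EdgeAt-ends e) eq (edgeAt e))

  EdgeAt-<ˡ : ∀ {k a b} → EdgeAt k a b → a < N
  EdgeAt-<ˡ (cycle 1+i<N) = <⇒≤ 1+i<N
  EdgeAt-<ˡ closing       = n<1+n M
  EdgeAt-<ˡ (spoke i<N)   = i<N

  EdgeAt-<ʳ : ∀ {k a b} → EdgeAt k a b → b < N
  EdgeAt-<ʳ (cycle 1+i<N) = 1+i<N
  EdgeAt-<ʳ closing       = s≤s z≤n
  EdgeAt-<ʳ (spoke _)     = s≤s z≤n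

  edgeOf : ∀ {k a b} → EdgeAt k a b → Fin (N + N)
  edgeOf (spoke i<N) = N ↑ʳ fromℕ< i<N
  edgeOf E           = fromℕ< (EdgeAt-<ˡ E) ↑ˡ N

  toℕ-edgeOf : ∀ {k a b} (E : EdgeAt k a b) → toℕ (edgeOf E) ≡ k
  toℕ-edgeOf (cycle 1+i<N) = trans (toℕ-↑ˡ _ N) (toℕ-fromℕ< _)
  toℕ-edgeOf closing       = trans (toℕ-↑ˡ _ N) (toℕ-fromℕ< (n<1+n M))
  toℕ-edgeOf (spoke i<N)   = trans (toℕ-↑ʳ N _) (cong (N +_) (toℕ-fromℕ< i<N))

  edgeOf-∈ : ∀ {T k a b} (E : EdgeAt k a b) → bit T k ≡ true → edgeOf E ∈ T
  edgeOf-∈ {T} E x = bit⇒∈ (trans (cong (bit T) (toℕ-edgeOf E)) x)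

  private
    joins-at : ∀ {e u′ w′ u w a b} → lookup (edges G) e ≡ (u′ , w′) → toℕ u′ ≡ a → toℕ w′ ≡ b →
               toℕ u ≡ a → toℕ w ≡ b → Joins G e u w
    joins-at eq p q p′ q′ =
      fwd (trans eq (cong₂ _,_ (toℕ-injective (trans p (sym p′))) (toℕ-injective (trans q (sym q′)))))

    toℕ-cycle-end : ∀ {i} (i<N : i < N) → toℕ (suc (toℕ (fromℕ< i<N)) mod N) ≡ suc i % N
    toℕ-cycle-end i<N = trans (toℕ-fromℕ< (m%n<n (suc (toℕ (fromℕ< i<N))) N))
                              (cong (λ x → suc x % N) (toℕ-fromℕ< i<N))

  edgeOf-joins : ∀ {k a b u w} (E : EdgeAt k a b) → toℕ u ≡ a → toℕ w ≡ b → Joins G (edgeOf E) u w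
  edgeOf-joins E@(cycle 1+i<N) =
    joins-at (wheelIdent-cycle M (fromℕ< (EdgeAt-<ˡ E))) (toℕ-fromℕ< (EdgeAt-<ˡ E))
             (trans (toℕ-cycle-end (EdgeAt-<ˡ E)) (m<n⇒m%n≡m 1+i<N))
  edgeOf-joins E@closing =
    joins-at (wheelIdent-cycle M (fromℕ< (EdgeAt-<ˡ E))) (toℕ-fromℕ< (EdgeAt-<ˡ E))
             (trans (toℕ-cycle-end (EdgeAt-<ˡ E)) (n%n≡0 N))
  edgeOf-joins (spoke i<N) = joins-at (wheelIdent-spoke M (fromℕ< i<N)) (toℕ-fromℕ< i<N) refl

  Reach : Subset (N + N) → ℕ → Set
  Reach T a = ∀ {u} → toℕ u ≡ a → Walk G T u zero

  reach-hub : ∀ {T} → Reach T 0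
  reach-hub {u = zero} refl = here

  reach-across : ∀ {T k a b} (E : EdgeAt k a b) → bit T k ≡ true → Reach T b → Reach T a
  reach-across E x R u≡a =
    step (edgeOf E) (edgeOf-∈ E x) (edgeOf-joins E u≡a (toℕ-fromℕ< _))
         (R (toℕ-fromℕ< (EdgeAt-<ʳ E)))

  reach-back : ∀ {T k a b} (E : EdgeAt k a b) → bit T k ≡ true → Reach T a → Reach T b
  reach-back E x R u≡b =
    step (edgeOf E) (edgeOf-∈ E x) (Joins-sym (edgeOf-joins E (toℕ-fromℕ< _) u≡b))
         (R (toℕ-fromℕ< (EdgeAt-<ˡ E)))

  reach-via-spoke : ∀ {T j} → j < N → spokeBit T j ≡ true → Reach T j
  reach-via-spoke j<N s = reach-across (spoke j<N) s reach-hub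

  walk-preservesℕ : ∀ {T u v} (P : ℕ → Set) →
                    (∀ {k a b} → EdgeAt k a b → bit T k ≡ true → P a ⇔ P b) →
                    Walk G T u v → P (toℕ u) → P (toℕ v)
  walk-preservesℕ {T} P closed =
    walk-preserves (P ∘ toℕ) λ e∈T j → case-edge (∈⇒bit e∈T) (Joins⇒EdgeAt j)
    where
    case-edge : ∀ {k a b} → bit T k ≡ true → EdgeAt k a b ⊎ EdgeAt k b a → P a → P b
    case-edge x (inj₁ E) = Equivalence.to (closed E x)
    case-edge x (inj₂ E) = Equivalence.from (closed E x)

  segment-isolated : ∀ {T a t} → a < t → t < N → bit T a ≡ false → bit T t ≡ false →
                     (∀ {i} → a < i → i ≤ t → spokeBit T i ≡ false) → ¬ Connected G T
  segment-isolated {T} {a} {t} a<t t<N cut-a cut-t spokeless connected =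
    n≮0 (proj₁ (walk-preservesℕ Inside closed (connected (fromℕ< 1+a<N) zero) (inside-start)))
    where
    Inside : ℕ → Set
    Inside x = a < x × x ≤ t
    1+a<N : suc a < N
    1+a<N = ≤-<-trans a<t t<N
    inside-start : Inside (toℕ (fromℕ< 1+a<N))
    inside-start rewrite toℕ-fromℕ< 1+a<N = ≤-refl , a<t
    closed : ∀ {k x y} → EdgeAt k x y → bit T k ≡ true → Inside x ⇔ Inside y
    closed (cycle _) c = mk⇔
      (λ (a<i , i≤t) → m<n⇒m<1+n a<i , ≤∧≢⇒< i≤t (bits-≢ T c cut-t))
      (λ (a<1+i , 1+i≤t) → ≤∧≢⇒< (≤-pred a<1+i) (bits-≢ T c cut-a ∘ sym) , <⇒≤ 1+i≤t)
    closed closing c = mk⇔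
      (λ (_ , M≤t) → ⊥-elim (bits-≢ T c cut-t (≤-antisym M≤t (≤-pred t<N)) ))
      (λ (a<0 , _) → ⊥-elim (n≮0 a<0))
    closed (spoke _) s = mk⇔
      (λ (a<i , i≤t) → ⊥-elim (bits-≢ T s (spokeless a<i i≤t) refl))
      (λ (a<0 , _) → ⊥-elim (n≮0 a<0))

  -- The vertices start + 1, …, j form a block that is cut off from start and has no spoke below j.
  record Loose (T : Subset (N + N)) (j : ℕ) : Set where
    constructor loose
    field
      {start}   : ℕ
      start<j   : start < j
      start-cut : bit T start ≡ false
      spokeless : ∀ {i} → start < i → i < j → spokeBit T i ≡ false

  loose-new : ∀ {T j} → bit T j ≡ false → Loose T (suc j)
  loose-new cut = loose ≤-refl cut (λ j<i i<1+j → ⊥-elim (<⇒≱ j<i (≤-pred i<1+j)))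

  loose-extend : ∀ {T j} → Loose T j → spokeBit T j ≡ false → Loose T (suc j)
  loose-extend {T} {j} L@(loose s<j cut spokeless) s = loose (m<n⇒m<1+n s<j) cut spokeless′
    where
    spokeless′ : ∀ {i} → Loose.start L < i → i < suc j → spokeBit T i ≡ false
    spokeless′ s<i i<1+j with m≤n⇒m<n∨m≡n (≤-pred i<1+j)
    ... | inj₁ i<j  = spokeless s<i i<j
    ... | inj₂ refl = s

  loose-─ : ∀ {T j} e → Loose T j → Loose (T - e) j
  loose-─ {T} e (loose s<j cut spokeless) =
    loose s<j (bit-─-false T e cut) (λ s<i i<j → bit-─-false T e (spokeless s<i i<j))

  loose-isolated : ∀ {T j} → Loose T j → j < N → bit T j ≡ false → spokeBit T j ≡ false →
                   ¬ Connected G T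
  loose-isolated {T} {j} L j<N cut s = segment-isolated start<j j<N start-cut cut spokeless′
    where
    open Loose L
    spokeless′ : ∀ {i} → start < i → i ≤ j → spokeBit T i ≡ false
    spokeless′ s<i i≤j with m≤n⇒m<n∨m≡n i≤j
    ... | inj₁ i<j  = spokeless s<i i<j
    ... | inj₂ refl = s

  -- Edge x is none of the edges c_i, s_i with i < j, read before vertex j.
  Fresh : ℕ → ℕ → Set
  Fresh j x = (j ≤ x × x < N) ⊎ N + j ≤ x

  fresh-zero : ∀ x → Fresh 0 x
  fresh-zero x with x <? N
  ... | yes x<N = inj₁ (z≤n , x<N)
  ... | no  x≮N = inj₂ (subst (_≤ x) (sym (+-identityʳ N)) (≮⇒≥ x≮N))

  fresh-suc : ∀ {j x} → Fresh j x → x ≢ j → x ≢ N + j → Fresh (suc j) x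
  fresh-suc (inj₁ (j≤x , x<N)) x≢j _     = inj₁ (≤∧≢⇒< j≤x (x≢j ∘ sym) , x<N)
  fresh-suc {j} {x} (inj₂ N+j≤x) _ x≢N+j =
    inj₂ (subst (_≤ x) (sym (+-suc N j)) (≤∧≢⇒< N+j≤x (x≢N+j ∘ sym)))

  fresh-pred : ∀ {j x} → Fresh (suc j) x → Fresh j x
  fresh-pred (inj₁ (j<x , x<N)) = inj₁ (<⇒≤ j<x , x<N)
  fresh-pred {j} (inj₂ N+1+j≤x) = inj₂ (≤-trans (+-monoʳ-≤ N (n≤1+n j)) N+1+j≤x)

  fresh-suc⁻ : ∀ {j x} → Fresh (suc j) x → x ≢ j × x ≢ N + j
  fresh-suc⁻ {j} (inj₁ (j<x , x<N)) =
    (λ { refl → <-irrefl refl j<x }) , (λ { refl → <⇒≱ x<N (m≤m+n N j) })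
  fresh-suc⁻ {j} (inj₂ N+1+j≤x) =
    (λ { refl → <⇒≱ N+j<N+1+j (≤-trans N+1+j≤x (m≤n+m j N)) }) , (λ { refl → <⇒≱ N+j<N+1+j N+1+j≤x })
    where
    N+j<N+1+j : N + j < N + suc j
    N+j<N+1+j = +-monoʳ-< N (n<1+n j)

  fresh-last : ∀ {x} → x < N + N → Fresh M x → x ≡ M ⊎ x ≡ N + M
  fresh-last x<N+N (inj₁ (M≤x , x<N)) = inj₁ (≤-antisym (≤-pred x<N) M≤x)
  fresh-last {x} x<N+N (inj₂ N+M≤x)   =
    inj₂ (≤-antisym (≤-pred (subst (x <_) (+-suc N M) x<N+N)) N+M≤x)

  Scan : Subset (N + N) → ℕ → Bool → Set
  Scan T = Run (bit T) (spokeBit T) M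

  Accepted : Subset (N + N) → Set
  Accepted T = Scan T 0 true

  Run-< : ∀ {c s j q} → Run c s M j q → j < N
  Run-< = s≤s ∘ Run-≤

  module _ {T : Subset (N + N)} where

    private
      Reach-if : Bool → ℕ → Set
      Reach-if q j = q ≡ true → Reach T j

      reach-next : ∀ {j q q′ a b} → Step q a b q′ → bit T j ≡ a → spokeBit T j ≡ b → suc j < N →
                   Reach-if q j → Reach-if q′ (suc j)
      reach-next grow      c s 1+j<N R = reach-back (cycle 1+j<N) c ∘ R
      reach-next hook-grow c s 1+j<N R =
        λ _ → reach-back (cycle 1+j<N) c (reach-via-spoke (<⇒≤ 1+j<N) s)
      reach-next hook-end  c s 1+j<N R = λ ()
      reach-next end       c s 1+j<N R = λ ()

      reach-here : ∀ {j q q′ a b} → Step q a b q′ → bit T j ≡ a → spokeBit T j ≡ b → suc j < N →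
                   Reach-if q j → Reach T (suc j) → Reach T j
      reach-here grow      c s 1+j<N R R′ = reach-across (cycle 1+j<N) c R′
      reach-here hook-grow c s 1+j<N R R′ = reach-via-spoke (<⇒≤ 1+j<N) s
      reach-here hook-end  c s 1+j<N R R′ = reach-via-spoke (<⇒≤ 1+j<N) s
      reach-here end       c s 1+j<N R R′ = R refl

      reach-last : ∀ {q a b} → Final q a b → bit T M ≡ a → spokeBit T M ≡ b → Reach-if q M → Reach T M
      reach-last hook-closing c s R = reach-across closing c reach-hub
      reach-last hook-spoke   c s R = reach-via-spoke (n<1+n M) s
      reach-last done         c s R = R refl

      reach-scan : ∀ {j q} → Scan T j q → Reach-if q j → ∀ {v} → j ≤ v → v ≤ M → Reach T v
      reach-scan (stop F c s) R j≤v v≤M rewrite ≤-antisym v≤M j≤v = reach-last F c s R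
      reach-scan (next st c s scan) R j≤v v≤M with m≤n⇒m<n∨m≡n j≤v
      ... | inj₁ j<v  = reach-scan scan (reach-next st c s (Run-< scan) R) j<v v≤M
      ... | inj₂ refl = reach-here st c s (Run-< scan) R
                          (reach-scan scan (reach-next st c s (Run-< scan) R) ≤-refl (Run-≤ scan))

    accepted⇒connected : Accepted T → Connected G T
    accepted⇒connected scan =
      connected-via zero λ u → reach-scan scan (λ _ → reach-hub) z≤n (≤-pred (toℕ<n u)) refl

  module _ {T : Subset (N + N)} (tree : IsSpanningTree G T) where

    private
      -- No edge read after j is needed to join j to the hub.
      Attached : ℕ → Set
      Attached j = ∀ e → Fresh j (toℕ e) → Reach (T - e) j

      State : Bool → ℕ → Set
      State false = Loose T
      State true  = Attached

      hub-edge-is-bridge : ∀ {k a} (E : EdgeAt k a 0) → bit T k ≡ true → ¬ Reach (T - edgeOf E) a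
      hub-edge-is-bridge E x R = spanning-tree-edge-is-bridge tree (edgeOf-∈ E x)
        (edgeOf-joins E (toℕ-fromℕ< (EdgeAt-<ˡ E)) refl) (R (toℕ-fromℕ< (EdgeAt-<ˡ E)))

      attached-hub-edge : ∀ {j k} → Attached j → (E : EdgeAt k j 0) → Fresh j k → bit T k ≡ true → ⊥
      attached-hub-edge A E fresh x =
        hub-edge-is-bridge E x (A (edgeOf E) (subst (Fresh _) (sym (toℕ-edgeOf E)) fresh))

      kept : ∀ {k} e → bit T k ≡ true → toℕ e ≢ k → bit (T - e) k ≡ true
      kept e x e≢k = trans (bit-─ T e (e≢k ∘ sym)) x

      attached-hook : ∀ {j} → bit T j ≡ true → spokeBit T j ≡ true → suc j < N → Attached (suc j)
      attached-hook c s 1+j<N e fresh =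
        reach-back (cycle 1+j<N) (kept e c (proj₁ e≢))
                   (reach-via-spoke (<⇒≤ 1+j<N) (kept e s (proj₂ e≢)))
        where
        e≢ : toℕ e ≢ _ × toℕ e ≢ N + _
        e≢ = fresh-suc⁻ fresh

      attached-grow : ∀ {j} → Attached j → bit T j ≡ true → suc j < N → Attached (suc j)
      attached-grow A c 1+j<N e fresh =
        reach-back (cycle 1+j<N) (kept e c (proj₁ (fresh-suc⁻ fresh))) (A e (fresh-pred fresh))

      tree-step : ∀ {j q} → suc j < N → State q j →
                  Σ[ q′ ∈ Bool ] State q′ (suc j) × (Scan T (suc j) q′ → Scan T j q)
      tree-step {j} {false} 1+j<N L with bit T j in c | spokeBit T j in s
      ... | true  | false = false , loose-extend L s , next grow c s
      ... | true  | true  = true , attached-hook c s 1+j<N , next hook-grow c s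
      ... | false | true  = false , loose-new c , next hook-end c s
      ... | false | false = ⊥-elim (loose-isolated L (<⇒≤ 1+j<N) c s (proj₁ tree))
      tree-step {j} {true} 1+j<N A with bit T j in c | spokeBit T j in s
      ... | _     | true  = ⊥-elim (attached-hub-edge A (spoke (<⇒≤ 1+j<N)) (inj₂ ≤-refl) s)
      ... | true  | false = true , attached-grow A c 1+j<N , next grow c s
      ... | false | false = false , loose-new c , next end c s

      tree-final : ∀ {q} → State q M → Scan T M q
      tree-final {false} L with bit T M in c | spokeBit T M in s
      ... | true  | false = stop hook-closing c s
      ... | false | true  = stop hook-spoke c s
      ... | false | false = ⊥-elim (loose-isolated L (n<1+n M) c s (proj₁ tree))
      ... | true  | true  =
        ⊥-elim (hub-edge-is-bridge E s (reach-across closing (kept (edgeOf E) c N+M≢M) reach-hub))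
        where
        E : EdgeAt (N + M) M 0
        E = spoke (n<1+n M)
        N+M≢M : toℕ (edgeOf E) ≢ M
        N+M≢M eq = <⇒≢ (m<n+m M {N} (s≤s z≤n)) (sym (trans (sym (toℕ-edgeOf E)) eq))
      tree-final {true} A with bit T M in c | spokeBit T M in s
      ... | false | false = stop done c s
      ... | true  | _     = ⊥-elim (attached-hub-edge A closing (inj₁ (≤-refl , n<1+n M)) c)
      ... | false | true  = ⊥-elim (attached-hub-edge A (spoke (n<1+n M)) (inj₂ ≤-refl) s)

      tree-scan : ∀ k {j q} → k + j ≡ M → State q j → Scan T j q
      tree-scan zero    refl st = tree-final st
      tree-scan (suc k) {j} 1+k+j≡M st
        with tree-step (s≤s (subst (suc j ≤_) 1+k+j≡M (s≤s (m≤n+m j k)))) st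
      ... | _ , st′ , extend = extend (tree-scan k (trans (+-suc k j) 1+k+j≡M) st′)

    spanning-tree⇒accepted : Accepted T
    spanning-tree⇒accepted = tree-scan M (+-identityʳ M) (λ e _ {u} → reach-hub {T - e} {u})

  module _ {T : Subset (N + N)} (e : Fin (N + N)) (e∈T : bit T (toℕ e) ≡ true)
           (connected : Connected G (T - e)) where

    private
      -- Either e is still unread, and so far T - e reads like T; or e was read while the current
      -- block was joined to the hub, and in T - e that block is loose.
      data Track : Bool → ℕ → Set where
        ahead-loose    : ∀ {j} → Fresh j (toℕ e) → Loose T j → Track false j
        ahead-attached : ∀ {j} → Fresh j (toℕ e) → Track true j
        behind         : ∀ {j} → Loose (T - e) j → Track true j

      removed : ∀ {k} → toℕ e ≡ k → bit (T - e) k ≡ false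
      removed refl = bit-─-self T e

      absent : ∀ {k} → bit T k ≡ false → bit (T - e) k ≡ false
      absent = bit-─-false T e

      not-e : ∀ {k} → bit T k ≡ false → toℕ e ≢ k
      not-e = bits-≢ T e∈T

      track-step : ∀ {j q q′ a b} → Step q a b q′ → bit T j ≡ a → spokeBit T j ≡ b → j < N →
                   Track q j → Track q′ (suc j)
      track-step {j} grow c s j<N (ahead-loose fresh L) with toℕ e ≟ j
      ... | yes e≡j = ⊥-elim (loose-isolated (loose-─ e L) j<N (removed e≡j) (absent s) connected)
      ... | no  e≢j = ahead-loose (fresh-suc fresh e≢j (not-e s)) (loose-extend L s)
      track-step {j} grow c s j<N (ahead-attached fresh) with toℕ e ≟ j
      ... | yes e≡j = behind (loose-new (removed e≡j))
      ... | no  e≢j = ahead-attached (fresh-suc fresh e≢j (not-e s))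
      track-step grow c s j<N (behind L) = behind (loose-extend L (absent s))
      track-step {j} hook-grow c s j<N (ahead-loose fresh L) with toℕ e ≟ j | toℕ e ≟ N + j
      ... | yes e≡j | _          = behind (loose-new (removed e≡j))
      ... | no _    | yes e≡N+j  = behind (loose-extend (loose-─ e L) (removed e≡N+j))
      ... | no e≢j  | no e≢N+j   = ahead-attached (fresh-suc fresh e≢j e≢N+j)
      track-step {j} hook-end c s j<N (ahead-loose fresh L) with toℕ e ≟ N + j
      ... | yes e≡N+j = ⊥-elim (loose-isolated (loose-─ e L) j<N (absent c) (removed e≡N+j) connected)
      ... | no  e≢N+j = ahead-loose (fresh-suc fresh (not-e c) e≢N+j) (loose-new c)
      track-step end c s j<N (ahead-attached fresh) =
        ahead-loose (fresh-suc fresh (not-e c) (not-e s)) (loose-new c)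
      track-step end c s j<N (behind L) = ⊥-elim (loose-isolated L j<N (absent c) (absent s) connected)

      track-final : ∀ {q a b} → Final q a b → bit T M ≡ a → spokeBit T M ≡ b → ¬ Track q M
      track-final hook-closing c s (ahead-loose fresh L) with fresh-last (toℕ<n e) fresh
      ... | inj₁ e≡M   = loose-isolated (loose-─ e L) (n<1+n M) (removed e≡M) (absent s) connected
      ... | inj₂ e≡N+M = not-e s e≡N+M
      track-final hook-spoke c s (ahead-loose fresh L) with fresh-last (toℕ<n e) fresh
      ... | inj₁ e≡M   = not-e c e≡M
      ... | inj₂ e≡N+M = loose-isolated (loose-─ e L) (n<1+n M) (absent c) (removed e≡N+M) connected
      track-final done c s (ahead-attached fresh) with fresh-last (toℕ<n e) fresh
      ... | inj₁ e≡M   = not-e c e≡M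
      ... | inj₂ e≡N+M = not-e s e≡N+M
      track-final done c s (behind L) = loose-isolated L (n<1+n M) (absent c) (absent s) connected

      track-scan : ∀ {j q} → Scan T j q → ¬ Track q j
      track-scan (stop F c s)       = track-final F c s
      track-scan (next st c s scan) = track-scan scan ∘ track-step st c s (<⇒≤ (Run-< scan))

    ¬accepted : ¬ Accepted T
    ¬accepted scan = track-scan scan (ahead-attached (fresh-zero (toℕ e)))

  accepted⇒minimal : ∀ {T} → Accepted T → ∀ e → e ∈ T → ¬ Connected G (T - e)
  accepted⇒minimal scan e e∈T connected = ¬accepted e (∈⇒bit e∈T) connected scan

  spanning-tree⇔accepted : ∀ {T} → IsSpanningTree G T ⇔ Accepted T
  spanning-tree⇔accepted =
    mk⇔ spanning-tree⇒accepted λ scan → accepted⇒connected scan , accepted⇒minimal scan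

  accepted-++ : ∀ (cs ss : Vec Bool N) → Accepted (cs ++ ss) ⇔ Accepts (cs , ss) true
  accepted-++ cs ss = mk⇔ (Run-cong cycles spokes) (Run-cong (sym ∘ cycles) (sym ∘ spokes))
    where
    cycles : ∀ {i} → i ≤ M → bit (cs ++ ss) i ≡ bit cs i
    cycles i≤M = bit-++ˡ cs ss (s≤s i≤M)
    spokes : ∀ {i} → i ≤ M → spokeBit (cs ++ ss) i ≡ bit ss i
    spokes {i} _ = bit-++ʳ cs ss i

  spanning-trees : List (Subset (N + N))
  spanning-trees = List.map (uncurry _++_) (accepted M true)

  ∈-spanning-trees : ∀ T → T ∈ₗ spanning-trees ⇔ IsSpanningTree G T
  ∈-spanning-trees T = mk⇔ to from
    where
    to : T ∈ₗ spanning-trees → IsSpanningTree G T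
    to T∈ with ∈-map⁻ (uncurry _++_) T∈
    ... | (cs , ss) , w∈ , refl = Equivalence.from spanning-tree⇔accepted
                                    (Equivalence.from (accepted-++ cs ss) (accepted-sound M true w∈))
    from : IsSpanningTree G T → T ∈ₗ spanning-trees
    from tree with Vec.splitAt N T
    ... | cs , ss , refl = ∈-map⁺ (uncurry _++_)
      (accepted-complete M true (cs , ss)
        (Equivalence.to (accepted-++ cs ss) (Equivalence.to spanning-tree⇔accepted tree)))

  spanning-tree-count : SpanningTreeCount G (fib (N + N))
  spanning-tree-count =
    spanning-trees , Unique.map⁺ ++-injective′ (accepted-unique M true) , ∈-spanning-trees ,
    trans (length-map (uncurry _++_) (accepted M true)) (proj₁ (length-accepted M))
    where
    ++-injective′ : ∀ {w w′ : Word N} → uncurry _++_ w ≡ uncurry _++_ w′ → w ≡ w′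
    ++-injective′ {cs , ss} {cs′ , ss′} eq with ++-injective cs cs′ eq
    ... | refl , refl = refl

theorem8 : (N : ℕ) → (h : 3 ≤ N) →
    (N % 2 ≡ 1 → SpanningTreeCount (wheelIdent N {{≥3⇒nonZero h}})
                   (fib N * (fib (N ∸ 1) + fib (suc N))))
    × (N % 2 ≡ 0 → SpanningTreeCount (wheelIdent N {{≥3⇒nonZero h}})
                   (_/_ (lucas N * (lucas N ∸ 2) * (lucas N + 2))
                        (lucas (N ∸ 1) + lucas (suc N)) {{lucasSum-nonZero N}}))
theorem8 (suc (suc (suc m))) (s≤s (s≤s (s≤s _))) =
    (λ _    → subst (SpanningTreeCount G) (fib-double M) spanning-tree-count)
  , (λ even → subst (SpanningTreeCount G) (fib-double≡lucas-quotient N even) spanning-tree-count)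
  where
  open IdentifiedWheel m
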